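{- If $G$ is a graph of diameter $2$, then $\chi_\mu(G)\le \chi_1(G)$.
   Context: All graphs are finite and simple. A geodesic is a shortest path. For $X\subseteq V(G)$, two vertices $x,y\in X$ are $X$-visible if some $x,y$-geodesic has no internal vertex in $X$; $X$ is a mutual-visibility (MV) set if every two of its vertices are $X$-visible. $\chi_\mu(G)$ is the least $k$ such that $V(G)$ can be partitioned into $k$ MV sets. A $(k,1)$-coloring of $G$ is a map $V(G)\to[k]$ such that every vertex has at most one neighbor of its own color (i.e., each color class induces a subgraph of maximum degree at most $1$); the $1$-defective chromatic number $\chi_1(G)$ is the least $k$ for which $G$ has a $(k,1)$-coloring. -}

module Defs where

open import Data.Nat using (ℕ; _≤_)
open import Data.Fin using (Fin)
open import Data.List using (List; []; _∷_; length)
open import Data.List.Relation.Unary.All using (All)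
open import Data.Product using (Σ; _×_; ∃; ∃-syntax)
open import Relation.Binary.PropositionalEquality using (_≡_)
open import Relation.Nullary using (¬_)
open import Level using (0ℓ) renaming (suc to lsuc)

record Graph (n : ℕ) : Set₁ where
  field
    Adj    : Fin n → Fin n → Set
    sym    : ∀ {x y} → Adj x y → Adj y x
    irrefl : ∀ {x} → ¬ Adj x x
open Graph public

module _ {n : ℕ} (G : Graph n) where

  -- Walk G x y is : a walk x, i₁, …, iₘ, y (at least one edge) whose
  -- internal vertices, in order, are the list is = [i₁ … iₘ].
  data Walk : Fin n → Fin n → List (Fin n) → Set where
    edge : ∀ {x y} → Adj G x y → Walk x y []
    step : ∀ {x z y is} → Adj G x z → Walk z y is → Walk x y (z ∷ is)

  Geodesic : Fin n → Fin n → List (Fin n) → Set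
  Geodesic x y is = Walk x y is × (∀ js → Walk x y js → length is ≤ length js)

  Visible : (Fin n → Set) → Fin n → Fin n → Set
  Visible X x y = ∃[ is ] (Geodesic x y is × All (λ v → ¬ X v) is)

  IsMV : (Fin n → Set) → Set
  IsMV X = ∀ x y → X x → X y → ¬ x ≡ y → Visible X x y

  MVPartition : ℕ → Set
  MVPartition k = Σ (Fin n → Fin k) λ c → ∀ i → IsMV (λ v → c v ≡ i)

  -- (k,1)-coloring: every vertex has at most one neighbour of its own colour
  DefectiveColoring : ℕ → Set
  DefectiveColoring k = Σ (Fin n → Fin k) λ c →
    ∀ v u w → Adj G v u → Adj G v w → c u ≡ c v → c w ≡ c v → u ≡ w

  IsLeast : (ℕ → Set) → ℕ → Set
  IsLeast P m = P m × (∀ k → P k → m ≤ k)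

  IsChiMu : ℕ → Set
  IsChiMu = IsLeast MVPartition

  IsChi1 : ℕ → Set
  IsChi1 = IsLeast DefectiveColoring

  -- diameter exactly 2: any two distinct vertices are at distance ≤ 2,
  -- and some two distinct vertices are at distance exactly 2 (non-adjacent)
  Diameter2 : Set
  Diameter2 =
    (∀ x y → ¬ x ≡ y → ∃[ is ] (Walk x y is × length is ≤ 1))
    × (∃[ x ] ∃[ y ] (¬ x ≡ y × ¬ Adj G x y))

{-# OPTIONS --safe #-}
-- In a graph of diameter 2, two non-adjacent vertices x, y of a colour class
-- of a (k,1)-colouring have a common neighbour z, and x–z–y is a geodesic.
-- If z had the same colour, it would have two distinct neighbours of its own
-- colour; so z lies outside the class and every colour class is an MV set.
-- Adjacency is not assumed decidable, but the conclusion a ≤ b is, so it may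
-- be proved under the double negation of decidability of adjacency.
module Submission where

open import Defs
open import Level using (Level)
open import Function using (_∘_)
open import Data.Nat using (ℕ; _≤_; z≤n; s≤s; _≤?_)
open import Data.Fin using (Fin; zero; suc; _≟_)
open import Data.Fin.Properties using (∀-cons)
open import Data.List using ([]; _∷_; length)
open import Data.List.Relation.Unary.All using ([]; _∷_)
open import Data.Product using (∃-syntax; _×_; _,_; proj₁)
open import Relation.Binary.PropositionalEquality using (_≡_; trans)
import Relation.Binary.PropositionalEquality as ≡
open import Relation.Nullary using (¬_; Dec; yes; no; contradiction)
open import Relation.Nullary.Decidable using (decidable-stable; ¬¬-excluded-middle)
open import Relation.Unary using (Pred; Decidable)

¬¬-Π-Fin : ∀ {p} {n : ℕ} {P : Fin n → Set p} → (∀ i → ¬ ¬ P i) → ¬ ¬ (∀ i → P i)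
¬¬-Π-Fin {n = ℕ.zero}  _ k = k λ ()
¬¬-Π-Fin {n = ℕ.suc n} h k = h zero λ p₀ → ¬¬-Π-Fin (h ∘ suc) (k ∘ ∀-cons p₀)

¬¬-decidable₂ : ∀ {r} {m n : ℕ} {R : Fin m → Fin n → Set r} → ¬ ¬ (∀ x y → Dec (R x y))
¬¬-decidable₂ = ¬¬-Π-Fin λ _ → ¬¬-Π-Fin λ _ → ¬¬-excluded-middle

module _ {n : ℕ} (G : Graph n) where

  DistanceAtMost2 : Set
  DistanceAtMost2 = ∀ x y → ¬ x ≡ y → ∃[ is ] (Walk G x y is × length is ≤ 1)

  InducedMaxDegree≤1 : Pred (Fin n) Level.zero → Set
  InducedMaxDegree≤1 X =
    ∀ {v u w} → X v → X u → X w → Adj G v u → Adj G v w → u ≡ w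

  adjacent⇒geodesic : ∀ {x y} → Adj G x y → Geodesic G x y []
  adjacent⇒geodesic xy = edge xy , λ _ _ → z≤n

  nonadjacent⇒geodesic : ∀ {x y z} → ¬ Adj G x y →
    Walk G x y (z ∷ []) → Geodesic G x y (z ∷ [])
  nonadjacent⇒geodesic ¬xy w = w , nonempty
    where
    nonempty : ∀ js → Walk G _ _ js → 1 ≤ length js
    nonempty _ (edge xy)  = contradiction xy ¬xy
    nonempty _ (step _ _) = s≤s z≤n

  maxDegree≤1⇒IsMV : (∀ x y → Dec (Adj G x y)) → DistanceAtMost2 →
    {X : Pred (Fin n) Level.zero} → Decidable X → InducedMaxDegree≤1 X → IsMV G X
  maxDegree≤1⇒IsMV adj? dist X? deg x y Xx Xy x≢y with adj? x y
  ... | yes xy = [] , adjacent⇒geodesic xy , []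
  ... | no ¬xy with dist x y x≢y
  ... | _ , edge xy , _ = contradiction xy ¬xy
  ... | _ , step _ (step _ _) , s≤s ()
  ... | z ∷ [] , step xz (edge zy) , _ with X? z
  ...   | yes Xz = contradiction (deg Xz Xx Xy (sym G xz) zy) x≢y
  ...   | no ¬Xz = z ∷ [] , nonadjacent⇒geodesic ¬xy (step xz (edge zy)) , ¬Xz ∷ []

  colourClass-maxDegree≤1 : ∀ {k} (C : DefectiveColoring G k) i →
    InducedMaxDegree≤1 (λ v → proj₁ C v ≡ i)
  colourClass-maxDegree≤1 (_ , defective) i cv cu cw vu vw =
    defective _ _ _ vu vw (trans cu (≡.sym cv)) (trans cw (≡.sym cv))

  defectiveColoring⇒MVPartition : ∀ {k} → (∀ x y → Dec (Adj G x y)) →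
    DistanceAtMost2 → DefectiveColoring G k → MVPartition G k
  defectiveColoring⇒MVPartition adj? dist C@(c , _) =
    c , λ i → maxDegree≤1⇒IsMV adj? dist (λ v → c v ≟ i) (colourClass-maxDegree≤1 C i)

proposition4p10 : (n : ℕ) (G : Graph n) → Diameter2 G →
    (a b : ℕ) → IsChiMu G a → IsChi1 G b → a ≤ b
proposition4p10 n G (dist , _) a b (_ , a-least) (C , _) =
  decidable-stable (a ≤? b) λ a≰b →
    ¬¬-decidable₂ λ adj? →
      a≰b (a-least b (defectiveColoring⇒MVPartition G adj? dist C))
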